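{- Let $\epsilon>0$ and $\delta>0$ be sufficiently small, and consider nine rectangle item types with (width, height): type 1: $(1/4-300\delta,\,1/6-2\epsilon)$; type 2: $(1/4+100\delta,\,1/6-2\epsilon)$; type 3: $(1/2+200\delta,\,1/6-2\epsilon)$; type 4: $(1/4-30\delta,\,1/3+\epsilon)$; type 5: $(1/4+10\delta,\,1/3+\epsilon)$; type 6: $(1/2+20\delta,\,1/3+\epsilon)$; type 7: $(1/4-3\delta,\,1/2+\epsilon)$; type 8: $(1/4+\delta,\,1/2+\epsilon)$; type 9: $(1/2+2\delta,\,1/2+\epsilon)$. Let $(\lambda_1,\dots,\lambda_9)=\frac{1}{413}(48,48,96,72,72,144,72,72,144)$ and for a pattern $p$ let $w(p)=\sum_{i=2}^{9}\lambda_i p_i$. Then over all patterns $p\in T_2$, the maximum of $w(p)$ is attained by each of the patterns $(0,6,0,8,0,0,0,0,0)$, $(0,12,0,4,0,0,0,0,0)$ and $(0,18,0,0,0,0,0,0,0)$.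
   Context: A pattern is a vector $p=(p_1,\dots,p_9)$ of nonnegative integers such that a multiset consisting of $p_i$ items of type $i$ ($i=1,\dots,9$) can be packed into the unit square bin: items placed axis-parallel in the given orientation (no rotation), inside $[0,1]^2$, with pairwise disjoint interiors. $T_j$ denotes the set of patterns whose first nonzero component is $p_j$ (i.e. whose smallest item type index used is $j$).
   Formalization: The parameters $\epsilon$ and $\delta$ are rational, and in a packing the items' lower-left corners and the points used to test disjointness of interiors are rational as well. -}

module Defs where

open import Data.Nat as ℕ using (ℕ)
open import Data.Integer using (+_)
open import Data.Rational using (ℚ; 0ℚ; 1ℚ; _+_; _-_; _*_; _<_; _≤_; _/_)
open import Data.Fin using (Fin; zero; suc; toℕ)
open import Data.List using (List; []; _∷_; length; concatMap; replicate; allFin; lookup)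
open import Data.Product using (Σ; _×_; _,_; proj₁; proj₂; ∃-syntax)
open import Data.Sum using (_⊎_)
open import Relation.Nullary using (¬_)
open import Relation.Binary.PropositionalEquality using (_≡_; _≢_)

-- Item types 1..9 are represented by Fin 9 (type k ↦ index k-1).
ItemType : Set
ItemType = Fin 9

q : ℕ → (d : ℕ) → .{{_ : ℕ.NonZero d}} → ℚ
q n d = (+ n) / d

width : ℚ → ℚ → ItemType → ℚ
width ε δ zero                                         = q 1 4 - q 300 1 * δ
width ε δ (suc zero)                                   = q 1 4 + q 100 1 * δ
width ε δ (suc (suc zero))                             = q 1 2 + q 200 1 * δ
width ε δ (suc (suc (suc zero)))                       = q 1 4 - q 30 1 * δ
width ε δ (suc (suc (suc (suc zero))))                 = q 1 4 + q 10 1 * δ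
width ε δ (suc (suc (suc (suc (suc zero)))))           = q 1 2 + q 20 1 * δ
width ε δ (suc (suc (suc (suc (suc (suc zero))))))     = q 1 4 - q 3 1 * δ
width ε δ (suc (suc (suc (suc (suc (suc (suc zero))))))) = q 1 4 + δ
width ε δ (suc (suc (suc (suc (suc (suc (suc (suc zero)))))))) = q 1 2 + q 2 1 * δ

height : ℚ → ℚ → ItemType → ℚ
height ε δ zero                                         = q 1 6 - q 2 1 * ε
height ε δ (suc zero)                                   = q 1 6 - q 2 1 * ε
height ε δ (suc (suc zero))                             = q 1 6 - q 2 1 * ε
height ε δ (suc (suc (suc zero)))                       = q 1 3 + ε
height ε δ (suc (suc (suc (suc zero))))                 = q 1 3 + ε
height ε δ (suc (suc (suc (suc (suc zero)))))           = q 1 3 + ε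
height ε δ (suc (suc (suc (suc (suc (suc zero))))))     = q 1 2 + ε
height ε δ (suc (suc (suc (suc (suc (suc (suc zero))))))) = q 1 2 + ε
height ε δ (suc (suc (suc (suc (suc (suc (suc (suc zero)))))))) = q 1 2 + ε

Pattern : Set
Pattern = ItemType → ℕ

items : Pattern → List ItemType
items p = concatMap (λ i → replicate (p i) i) (allFin 9)

InInterior : ℚ → ℚ → ItemType → ℚ × ℚ → ℚ × ℚ → Set
InInterior ε δ t (x , y) (a , b) =
  (x < a) × (a < x + width ε δ t) × (y < b) × (b < y + height ε δ t)

Packing : ℚ → ℚ → Pattern → Set
Packing ε δ p =
  let L = items p in
  Σ (Fin (length L) → ℚ × ℚ) λ pos →
    ( (∀ k → let t = lookup L k ; x = proj₁ (pos k) ; y = proj₂ (pos k) in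
               (0ℚ ≤ x) × (x + width ε δ t ≤ 1ℚ) × (0ℚ ≤ y) × (y + height ε δ t ≤ 1ℚ))
    × (∀ k l → k ≢ l → ∀ (z : ℚ × ℚ) →
         ¬ (InInterior ε δ (lookup L k) (pos k) z × InInterior ε δ (lookup L l) (pos l) z)))

IsPattern : ℚ → ℚ → Pattern → Set
IsPattern ε δ p = Packing ε δ p

InT : ℚ → ℚ → ItemType → Pattern → Set
InT ε δ j p = IsPattern ε δ p × (∀ i → toℕ i ℕ.< toℕ j → p i ≡ 0) × (p j ≢ 0)

lam : ItemType → ℚ
lam zero                                         = q 48 413
lam (suc zero)                                   = q 48 413
lam (suc (suc zero))                             = q 96 413
lam (suc (suc (suc zero)))                       = q 72 413
lam (suc (suc (suc (suc zero))))                 = q 72 413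
lam (suc (suc (suc (suc (suc zero)))))           = q 144 413
lam (suc (suc (suc (suc (suc (suc zero))))))     = q 72 413
lam (suc (suc (suc (suc (suc (suc (suc zero))))))) = q 72 413
lam (suc (suc (suc (suc (suc (suc (suc (suc zero)))))))) = q 144 413

weight : Pattern → ℚ
weight p = Data.List.foldr _+_ 0ℚ
  (Data.List.map (λ i → lam i * q (p i) 1) (Data.List.drop 1 (allFin 9)))

pat : ℕ → ℕ → ℕ → ℕ → ℕ → ℕ → ℕ → ℕ → ℕ → Pattern
pat a b c d e f g h k zero = a
pat a b c d e f g h k (suc zero) = b
pat a b c d e f g h k (suc (suc zero)) = c
pat a b c d e f g h k (suc (suc (suc zero))) = d
pat a b c d e f g h k (suc (suc (suc (suc zero)))) = e
pat a b c d e f g h k (suc (suc (suc (suc (suc zero))))) = f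
pat a b c d e f g h k (suc (suc (suc (suc (suc (suc zero)))))) = g
pat a b c d e f g h k (suc (suc (suc (suc (suc (suc (suc zero))))))) = h
pat a b c d e f g h k (suc (suc (suc (suc (suc (suc (suc (suc zero)))))))) = k

two : ItemType
two = suc zero

AttainsMaxT2 : ℚ → ℚ → Pattern → Set
AttainsMaxT2 ε δ r = InT ε δ two r × (∀ p → InT ε δ two p → weight p ≤ weight r)

-- Draw the six horizontal lines y = j/7 (j = 1, …, 6). An item of type t is taller than r_t/7, where
-- r_t = 1, 2, 3 for the three height classes, so in any packing it crosses at least r_t of these lines.
-- Charge an item μ_t on each line it crosses, with r_t μ_t = 413 λ_t (and μ_1 = 0, since w ignores type 1).
-- The items crossing one line have disjoint x-ranges inside [0, 1], so their widths add up to at most 1;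
-- as every item is wider than 1/5 there are at most four of them, and checking the finitely many lists of
-- at most four types shows that their charges add up to at most 144. Double counting gives
-- 413 w(p) ≤ 6 · 144 = 864 for every pattern p, and the three given patterns reach 864 with explicit packings.
-- Every inequality used is affine in (ε, δ); it is certified on the whole box 0 < ε < 1/100, 0 < δ < 1/12000
-- by evaluating the affine form at the worst corner.
module Submission where

open import Defs
open import Data.Nat as ℕ using (ℕ; zero; suc; z≤n; s≤s; _<ᵇ_; _∸_)
import Data.Nat.Properties as ℕ
open import Data.Nat.DivMod using (_/_; _%_)
open import Data.Nat.ListAction using (sum)
open import Data.Nat.ListAction.Properties using (sum-++)
open import Algebra.Properties.Semiring.Sum ℕ.+-*-semiring using (sum-syntax; ∑-comm; *-distribʳ-sum)
import Data.Integer as ℤ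
import Data.Integer.Properties as ℤ
import Data.Integer.Solver as ℤ-Solver
open import Data.Rational
  using (ℚ; 0ℚ; 1ℚ; _+_; _-_; _*_; -_; _⊓_; _⊔_; _≤_; _<_; _≤?_; _<?_; _≟_; toℚᵘ;
         nonPositive; nonNegative; positive; negative)
open import Data.Rational.Properties
open import Data.Rational.Solver using (module +-*-Solver)
import Data.Rational.Unnormalised as ℚᵘ
import Data.Rational.Unnormalised.Properties as ℚᵘ
open import Data.Bool using (Bool; true; false; T; _∧_; if_then_else_)
open import Data.Bool.Properties using (T-∧)
open import Data.Fin as Fin using (Fin; zero; suc; toℕ)
open import Data.Fin.Properties as Fin using (all?)
open import Data.List
  using (List; []; _∷_; _++_; foldr; map; filter; length; lookup; allFin; tabulate; replicate; concatMap; drop)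
open import Data.List.Properties using (length-filter; map-++; map-∘; foldr-map)
open import Data.List.Relation.Unary.All as All using (All; []; _∷_)
import Data.List.Relation.Unary.All.Properties as All
open import Data.List.Relation.Unary.AllPairs using (AllPairs; []; _∷_)
import Data.List.Relation.Unary.AllPairs.Properties as AllPairs
import Data.List.Relation.Unary.Unique.Propositional.Properties as Unique
open import Data.Product using (_×_; _,_; proj₁; proj₂; ∃-syntax)
open import Data.Sum using (_⊎_; inj₁; inj₂; [_,_]′)
open import Function using (Equivalence; _∘_; _∘′_; id)
open import Relation.Binary.Definitions using (tri<; tri≈; tri>)
open import Relation.Binary.PropositionalEquality
open import Relation.Nullary using (Dec; yes; no; ¬_; ¬?; contradiction)
open import Relation.Nullary.Decidable using (map′; isYes; from-yes; fromWitness; _×-dec_; _⊎-dec_)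
open import Relation.Unary using (Decidable)

<⇒≱ : ∀ {x y : ℚ} → x < y → ¬ (y ≤ x)
<⇒≱ x<y y≤x = <-irrefl refl (<-≤-trans x<y y≤x)

toℚᵘ-q : ∀ n d → toℚᵘ (q n (suc d)) ℚᵘ.≃ ℚᵘ.mkℚᵘ (ℤ.+ n) d
toℚᵘ-q n d = toℚᵘ-fromℚᵘ (ℚᵘ.mkℚᵘ (ℤ.+ n) d)

q-+ : ∀ m n d → q (m ℕ.+ n) (suc d) ≡ q m (suc d) + q n (suc d)
q-+ m n d = toℚᵘ-injective (begin
    toℚᵘ (q (m ℕ.+ n) (suc d))                     ≈⟨ toℚᵘ-q (m ℕ.+ n) d ⟩
    ℚᵘ.mkℚᵘ (ℤ.+ (m ℕ.+ n)) d                         ≈⟨ ℚᵘ.*≡* cross ⟩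
    ℚᵘ.mkℚᵘ (ℤ.+ m) d ℚᵘ.+ ℚᵘ.mkℚᵘ (ℤ.+ n) d             ≈⟨ ℚᵘ.+-cong (ℚᵘ.≃-sym (toℚᵘ-q m d)) (ℚᵘ.≃-sym (toℚᵘ-q n d)) ⟩
    toℚᵘ (q m (suc d)) ℚᵘ.+ toℚᵘ (q n (suc d))      ≈⟨ ℚᵘ.≃-sym (toℚᵘ-homo-+ (q m (suc d)) (q n (suc d))) ⟩
    toℚᵘ (q m (suc d) + q n (suc d))                ∎)
  where
  open ℚᵘ.≃-Reasoning
  open ℤ-Solver.+-*-Solver
  D = ℤ.+ suc d
  cross : ℤ.+ (m ℕ.+ n) ℤ.* (D ℤ.* D) ≡ (ℤ.+ m ℤ.* D ℤ.+ ℤ.+ n ℤ.* D) ℤ.* D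
  cross = trans (cong (ℤ._* (D ℤ.* D)) (ℤ.pos-+ m n))
    (solve 3 (λ a b e → (a :+ b) :* (e :* e) := (a :* e :+ b :* e) :* e) refl (ℤ.+ m) (ℤ.+ n) D)

q-*-q1 : ∀ a m d → q a (suc d) * q m 1 ≡ q (a ℕ.* m) (suc d)
q-*-q1 a m d = toℚᵘ-injective (begin
    toℚᵘ (q a (suc d) * q m 1)                 ≈⟨ toℚᵘ-homo-* (q a (suc d)) (q m 1) ⟩
    toℚᵘ (q a (suc d)) ℚᵘ.* toℚᵘ (q m 1)       ≈⟨ ℚᵘ.*-cong (toℚᵘ-q a d) (toℚᵘ-q m 0) ⟩
    ℚᵘ.mkℚᵘ (ℤ.+ a) d ℚᵘ.* ℚᵘ.mkℚᵘ (ℤ.+ m) 0       ≈⟨ ℚᵘ.*≡* cross ⟩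
    ℚᵘ.mkℚᵘ (ℤ.+ (a ℕ.* m)) d                    ≈⟨ ℚᵘ.≃-sym (toℚᵘ-q (a ℕ.* m) d) ⟩
    toℚᵘ (q (a ℕ.* m) (suc d))                 ∎)
  where
  open ℚᵘ.≃-Reasoning
  cross : (ℤ.+ a ℤ.* ℤ.+ m) ℤ.* ℤ.+ suc d ≡ ℤ.+ (a ℕ.* m) ℤ.* ℤ.+ (suc d ℕ.* 1)
  cross = cong₂ ℤ._*_ (sym (ℤ.pos-* a m)) (cong ℤ.+_ (sym (ℕ.*-identityʳ (suc d))))

q-mono-≤ : ∀ {m n} d → m ℕ.≤ n → q m (suc d) ≤ q n (suc d)
q-mono-≤ {m} {n} d m≤n = begin
  q m (suc d)                    ≡⟨ +-identityʳ (q m (suc d)) ⟨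
  q m (suc d) + 0ℚ               ≤⟨ +-monoʳ-≤ (q m (suc d)) (nonNegative⁻¹ (q (n ℕ.∸ m) (suc d)) {{normalize-nonNeg (n ℕ.∸ m) (suc d)}}) ⟩
  q m (suc d) + q (n ℕ.∸ m) (suc d) ≡⟨ q-+ m (n ℕ.∸ m) d ⟨
  q (m ℕ.+ (n ℕ.∸ m)) (suc d)    ≡⟨ cong (λ k → q k (suc d)) (ℕ.m+[n∸m]≡n m≤n) ⟩
  q n (suc d)                    ∎
  where open ≤-Reasoning

q-cancel-< : ∀ {m n} d → q m (suc d) < q n (suc d) → m ℕ.< n
q-cancel-< {m} {n} d qm<qn = ℕ.≰⇒> (λ n≤m → <⇒≱ qm<qn (q-mono-≤ d n≤m))

-- Intervals on a line

⊔-lub-< : ∀ {a c x} → a < x → c < x → a ⊔ c < x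
⊔-lub-< {a} {c} a<x c<x with ⊔-sel a c
... | inj₁ a⊔c≡a = subst (_< _) (sym a⊔c≡a) a<x
... | inj₂ a⊔c≡c = subst (_< _) (sym a⊔c≡c) c<x

⊓-glb-< : ∀ {x b d} → x < b → x < d → x < b ⊓ d
⊓-glb-< {x} {b} {d} x<b x<d with ⊓-sel b d
... | inj₁ b⊓d≡b = subst (_ <_) (sym b⊓d≡b) x<b
... | inj₂ b⊓d≡d = subst (_ <_) (sym b⊓d≡d) x<d

open-intervals-meet : ∀ {a b c d} → a < b → c < d → c < b → a < d → ∃[ z ] ((a < z × z < b) × (c < z × z < d))
open-intervals-meet {a} {b} {c} {d} a<b c<d c<b a<d
  with <-dense (⊔-lub-< (⊓-glb-< a<b a<d) (⊓-glb-< c<b c<d))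
... | z , a⊔c<z , z<b⊓d =
  z , (≤-<-trans (p≤p⊔q a c) a⊔c<z , <-≤-trans z<b⊓d (p⊓q≤p b d))
    , (≤-<-trans (p≤q⊔p a c) a⊔c<z , <-≤-trans z<b⊓d (p⊓q≤q b d))

module Intervals {I : Set} (x w : I → ℚ) where

  Disjoint : I → I → Set
  Disjoint k l = x k + w k ≤ x l ⊎ x l + w l ≤ x k

  Within : ℚ → ℚ → I → Set
  Within lo hi k = lo ≤ x k × x k + w k ≤ hi

  totalLength : List I → ℚ
  totalLength = foldr (λ k s → w k + s) 0ℚ

  totalLength-filter : ∀ {P : I → Set} (P? : ∀ k → Dec (P k)) S →
    totalLength S ≡ totalLength (filter P? S) + totalLength (filter (λ k → ¬? (P? k)) S)
  totalLength-filter P? [] = sym (+-identityʳ 0ℚ)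
  totalLength-filter P? (k ∷ S) with P? k
  ... | yes _ = trans (cong (w k +_) (totalLength-filter P? S)) (sym (+-assoc (w k) _ _))
  ... | no _ = trans (cong (w k +_) (totalLength-filter P? S))
                     (solve 3 (λ a b c → a :+ (b :+ c) := b :+ (a :+ c)) refl (w k) (totalLength yes-part) (totalLength no-part))
    where
    open +-*-Solver
    yes-part = filter P? S
    no-part  = filter (λ k → ¬? (P? k)) S

  -- The other intervals lie left or right of the first one; recurse on both sides (n bounds the length).
  totalLength-≤ : ∀ {lo hi} S → AllPairs Disjoint S → All (Within lo hi) S → lo ≤ hi → lo + totalLength S ≤ hi
  totalLength-≤ S = go (length S) S ℕ.≤-refl
    where
    go : ∀ n {lo hi} S → length S ℕ.≤ n → AllPairs Disjoint S → All (Within lo hi) S → lo ≤ hi → lo + totalLength S ≤ hi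
    go n {lo} {hi} [] _ _ _ lo≤hi = subst (_≤ hi) (sym (+-identityʳ lo)) lo≤hi
    go (suc n) {lo} {hi} (k ∷ S) (s≤s |S|≤n) (k-disjoint ∷ S-disjoint) ((lo≤xk , xk+wk≤hi) ∷ S-within) _ = begin
      lo + (w k + totalLength S)                    ≡⟨ cong (λ s → lo + (w k + s)) (totalLength-filter Left? S) ⟩
      lo + (w k + (totalLength L + totalLength R))  ≡⟨ solve 4 (λ a b c d → a :+ (b :+ (c :+ d)) := (a :+ c) :+ b :+ d) refl lo (w k) (totalLength L) (totalLength R) ⟩
      lo + totalLength L + w k + totalLength R      ≤⟨ +-monoˡ-≤ (totalLength R) (+-monoˡ-≤ (w k) left-fits) ⟩
      x k + w k + totalLength R                     ≤⟨ right-fits ⟩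
      hi                                            ∎
      where
      open ≤-Reasoning
      open +-*-Solver
      Left? : ∀ l → Dec (x l + w l ≤ x k)
      Left? l = x l + w l ≤? x k
      L = filter Left? S
      R = filter (λ l → ¬? (Left? l)) S

      right-of-k : ∀ {l} → Disjoint k l → ¬ (x l + w l ≤ x k) → x k + w k ≤ x l
      right-of-k (inj₁ right) _ = right
      right-of-k (inj₂ left) not-left = contradiction left not-left

      left-fits : lo + totalLength L ≤ x k
      left-fits = go n L (ℕ.≤-trans (length-filter Left? S) |S|≤n) (AllPairs.filter⁺ Left? S-disjoint)
        (All.zipWith (λ { ((lo≤xl , _) , left) → lo≤xl , left }) (All.filter⁺ Left? S-within , All.all-filter Left? S))
        lo≤xk

      right-fits : x k + w k + totalLength R ≤ hi
      right-fits = go n R (ℕ.≤-trans (length-filter _ S) |S|≤n) (AllPairs.filter⁺ _ S-disjoint)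
        (All.zipWith (λ { ((_ , xl+wl≤hi) , (disjoint , not-left)) → right-of-k disjoint not-left , xl+wl≤hi })
          (All.filter⁺ _ S-within , All.zip (All.filter⁺ _ k-disjoint , All.all-filter (λ l → ¬? (Left? l)) S)))
        xk+wk≤hi

𝟙 : Bool → ℕ
𝟙 true  = 1
𝟙 false = 0

𝟙-mono : ∀ {b c} → (T b → T c) → 𝟙 b ℕ.≤ 𝟙 c
𝟙-mono {false}         _   = z≤n
𝟙-mono {true} {true}   _   = ℕ.≤-refl
𝟙-mono {true} {false}  b⇒c = contradiction (b⇒c _) λ ()

∑-mono-≤ : ∀ {n} {f g : Fin n → ℕ} → (∀ i → f i ℕ.≤ g i) → ∑[ i < n ] f i ℕ.≤ ∑[ i < n ] g i
∑-mono-≤ {zero}  _     = z≤n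
∑-mono-≤ {suc n} f≤g = ℕ.+-mono-≤ (f≤g zero) (∑-mono-≤ (f≤g ∘ suc))

∑-lookup : ∀ {A : Set} (f : A → ℕ) (L : List A) → ∑[ k < length L ] f (lookup L k) ≡ sum (map f L)
∑-lookup f []      = refl
∑-lookup f (x ∷ L) = cong (f x ℕ.+_) (∑-lookup f L)

∑-𝟙*≡sum-filter : ∀ {A : Set} {P : A → Set} (P? : Decidable P) (f : A → ℕ) {n} (g : Fin n → A) →
  ∑[ k < n ] (𝟙 (isYes (P? (g k))) ℕ.* f (g k)) ≡ sum (map f (filter P? (tabulate g)))
∑-𝟙*≡sum-filter P? f {zero}  g = refl
∑-𝟙*≡sum-filter P? f {suc n} g with P? (g zero)
... | yes _ = cong₂ ℕ._+_ (ℕ.+-identityʳ (f (g zero))) (∑-𝟙*≡sum-filter P? f (g ∘ suc))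
... | no  _ = ∑-𝟙*≡sum-filter P? f (g ∘ suc)

sum-map-replicate : ∀ {A : Set} (f : A → ℕ) m x → sum (map f (replicate m x)) ≡ f x ℕ.* m
sum-map-replicate f zero    x = sym (ℕ.*-zeroʳ (f x))
sum-map-replicate f (suc m) x = trans (cong (f x ℕ.+_) (sum-map-replicate f m x)) (sym (ℕ.*-suc (f x) m))

∀-length≤? : ∀ {n} {P : List (Fin n) → Set} → (∀ xs → Dec (P xs)) → ∀ m → Dec (∀ xs → length xs ℕ.≤ m → P xs)
∀-length≤? P? zero = map′ (λ p → λ { [] _ → p }) (λ h → h [] z≤n) (P? [])
∀-length≤? P? (suc m) =
  map′ (λ { (p , h) → λ { [] _ → p ; (x ∷ xs) (s≤s l) → h x xs l } })
       (λ h → h [] z≤n , λ x xs l → h (x ∷ xs) (s≤s l))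
       (P? [] ×-dec all? (λ x → ∀-length≤? (λ xs → P? (x ∷ xs)) m))

-- Affine forms in (ε, δ) on a box

record Affine : Set where
  constructor affine
  field
    offset εCoeff δCoeff : ℚ

open Affine public

⟦_⟧ : Affine → ℚ → ℚ → ℚ
⟦ affine a b c ⟧ ε δ = a + b * ε + c * δ

constant : ℚ → Affine
constant a = affine a 0ℚ 0ℚ

infixl 6 _⊕_ _⊖_

_⊕_ : Affine → Affine → Affine
affine a b c ⊕ affine a′ b′ c′ = affine (a + a′) (b + b′) (c + c′)

_⊖_ : Affine → Affine → Affine
affine a b c ⊖ affine a′ b′ c′ = affine (a - a′) (b - b′) (c - c′)

⟦constant⟧ : ∀ a ε δ → ⟦ constant a ⟧ ε δ ≡ a
⟦constant⟧ a ε δ = solve 3 (λ a ε δ → a :+ con 0ℚ :* ε :+ con 0ℚ :* δ := a) refl a ε δ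
  where open +-*-Solver

⟦⊕⟧ : ∀ u v ε δ → ⟦ u ⊕ v ⟧ ε δ ≡ ⟦ u ⟧ ε δ + ⟦ v ⟧ ε δ
⟦⊕⟧ (affine a b c) (affine a′ b′ c′) ε δ =
  solve 8 (λ a b c a′ b′ c′ ε δ →
             (a :+ a′) :+ (b :+ b′) :* ε :+ (c :+ c′) :* δ := (a :+ b :* ε :+ c :* δ) :+ (a′ :+ b′ :* ε :+ c′ :* δ))
          refl a b c a′ b′ c′ ε δ
  where open +-*-Solver

⟦⟧-+-⟦⊖⟧ : ∀ u v ε δ → ⟦ u ⟧ ε δ + ⟦ v ⊖ u ⟧ ε δ ≡ ⟦ v ⟧ ε δ
⟦⟧-+-⟦⊖⟧ (affine a b c) (affine a′ b′ c′) ε δ =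
  solve 8 (λ a b c a′ b′ c′ ε δ →
             (a :+ b :* ε :+ c :* δ) :+ ((a′ :- a) :+ (b′ :- b) :* ε :+ (c′ :- c) :* δ) := a′ :+ b′ :* ε :+ c′ :* δ)
          refl a b c a′ b′ c′ ε δ
  where open +-*-Solver

NonConstant : Affine → Set
NonConstant u = εCoeff u ≢ 0ℚ ⊎ δCoeff u ≢ 0ℚ

module OpenBox (ε⁺ δ⁺ : ℚ) where

  record InBox (ε δ : ℚ) : Set where
    field
      0<ε  : 0ℚ < ε
      ε<ε⁺ : ε < ε⁺
      0<δ  : 0ℚ < δ
      δ<δ⁺ : δ < δ⁺

  -- The minimum over the closed box [0, ε⁺] × [0, δ⁺]: each variable sits at 0 or at its bound, by the sign of its coefficient.
  infimum : Affine → ℚ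
  infimum (affine a b c) = a + (b ⊓ 0ℚ) * ε⁺ + (c ⊓ 0ℚ) * δ⁺

  infix 4 _≤ᴮ_ _<ᴮ_ _≤ᴮ?_ _<ᴮ?_

  record _≤ᴮ_ (u v : Affine) : Set where
    constructor ≤ᴮ-by
    field
      difference-nonNegative : 0ℚ ≤ infimum (v ⊖ u)

  -- On the open box a form exceeds its infimum strictly unless it is constant.
  record _<ᴮ_ (u v : Affine) : Set where
    constructor <ᴮ-by
    field
      difference-positive : 0ℚ < infimum (v ⊖ u) ⊎ (0ℚ ≤ infimum (v ⊖ u) × NonConstant (v ⊖ u))

  _≤ᴮ?_ : ∀ u v → Dec (u ≤ᴮ v)
  u ≤ᴮ? v = map′ ≤ᴮ-by _≤ᴮ_.difference-nonNegative (0ℚ ≤? infimum (v ⊖ u))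

  _<ᴮ?_ : ∀ u v → Dec (u <ᴮ v)
  u <ᴮ? v = map′ <ᴮ-by _<ᴮ_.difference-positive
    (0ℚ <? infimum w ⊎-dec (0ℚ ≤? infimum w ×-dec (¬? (εCoeff w ≟ 0ℚ) ⊎-dec ¬? (δCoeff w ≟ 0ℚ))))
    where w = v ⊖ u

  private
    ⊓0-*-≤ : ∀ b {x x⁺} → 0ℚ ≤ x → x ≤ x⁺ → (b ⊓ 0ℚ) * x⁺ ≤ b * x
    ⊓0-*-≤ b {x} {x⁺} 0≤x x≤x⁺ with b ≤? 0ℚ
    ... | yes b≤0 rewrite p≤q⇒p⊓q≡p b≤0 = *-monoˡ-≤-nonPos b {{nonPositive b≤0}} x≤x⁺
    ... | no b≰0 rewrite p≥q⇒p⊓q≡q (<⇒≤ (≰⇒> b≰0)) | *-zeroˡ x⁺ =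
      subst (_≤ b * x) (*-zeroʳ b) (*-monoˡ-≤-nonNeg b {{nonNegative (<⇒≤ (≰⇒> b≰0))}} 0≤x)

    ⊓0-*-< : ∀ b {x x⁺} → b ≢ 0ℚ → 0ℚ < x → x < x⁺ → (b ⊓ 0ℚ) * x⁺ < b * x
    ⊓0-*-< b {x} {x⁺} b≢0 0<x x<x⁺ with <-cmp b 0ℚ
    ... | tri< b<0 _ _ rewrite p≤q⇒p⊓q≡p (<⇒≤ b<0) = *-monoʳ-<-neg b {{negative b<0}} x<x⁺
    ... | tri≈ _ b≡0 _ = contradiction b≡0 b≢0
    ... | tri> _ _ b>0 rewrite p≥q⇒p⊓q≡q (<⇒≤ b>0) | *-zeroˡ x⁺ =
      subst (_< b * x) (*-zeroʳ b) (*-monoʳ-<-pos b {{positive b>0}} 0<x)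

  module _ {ε δ : ℚ} (box : InBox ε δ) where
    open InBox box

    infimum-≤ : ∀ u → infimum u ≤ ⟦ u ⟧ ε δ
    infimum-≤ (affine a b c) =
      +-mono-≤ (+-monoʳ-≤ a (⊓0-*-≤ b (<⇒≤ 0<ε) (<⇒≤ ε<ε⁺))) (⊓0-*-≤ c (<⇒≤ 0<δ) (<⇒≤ δ<δ⁺))

    infimum-< : ∀ u → NonConstant u → infimum u < ⟦ u ⟧ ε δ
    infimum-< (affine a b c) (inj₁ b≢0) =
      +-mono-<-≤ (+-monoʳ-< a (⊓0-*-< b b≢0 0<ε ε<ε⁺)) (⊓0-*-≤ c (<⇒≤ 0<δ) (<⇒≤ δ<δ⁺))
    infimum-< (affine a b c) (inj₂ c≢0) =
      +-mono-≤-< (+-monoʳ-≤ a (⊓0-*-≤ b (<⇒≤ 0<ε) (<⇒≤ ε<ε⁺))) (⊓0-*-< c c≢0 0<δ δ<δ⁺)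

    ≤ᴮ-sound : ∀ {u v} → u ≤ᴮ v → ⟦ u ⟧ ε δ ≤ ⟦ v ⟧ ε δ
    ≤ᴮ-sound {u} {v} (≤ᴮ-by 0≤inf) = begin
      ⟦ u ⟧ ε δ                    ≡⟨ +-identityʳ (⟦ u ⟧ ε δ) ⟨
      ⟦ u ⟧ ε δ + 0ℚ               ≤⟨ +-monoʳ-≤ (⟦ u ⟧ ε δ) (≤-trans 0≤inf (infimum-≤ (v ⊖ u))) ⟩
      ⟦ u ⟧ ε δ + ⟦ v ⊖ u ⟧ ε δ    ≡⟨ ⟦⟧-+-⟦⊖⟧ u v ε δ ⟩
      ⟦ v ⟧ ε δ                    ∎
      where open ≤-Reasoning

    <ᴮ-sound : ∀ {u v} → u <ᴮ v → ⟦ u ⟧ ε δ < ⟦ v ⟧ ε δ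
    <ᴮ-sound {u} {v} (<ᴮ-by inf-positive) = begin-strict
      ⟦ u ⟧ ε δ                    ≡⟨ +-identityʳ (⟦ u ⟧ ε δ) ⟨
      ⟦ u ⟧ ε δ + 0ℚ               <⟨ +-monoʳ-< (⟦ u ⟧ ε δ) (⟦v⊖u⟧-positive inf-positive) ⟩
      ⟦ u ⟧ ε δ + ⟦ v ⊖ u ⟧ ε δ    ≡⟨ ⟦⟧-+-⟦⊖⟧ u v ε δ ⟩
      ⟦ v ⟧ ε δ                    ∎
      where
      open ≤-Reasoning
      ⟦v⊖u⟧-positive : 0ℚ < infimum (v ⊖ u) ⊎ (0ℚ ≤ infimum (v ⊖ u) × NonConstant (v ⊖ u)) → 0ℚ < ⟦ v ⊖ u ⟧ ε δ
      ⟦v⊖u⟧-positive (inj₁ 0<inf)          = <-≤-trans 0<inf (infimum-≤ (v ⊖ u))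
      ⟦v⊖u⟧-positive (inj₂ (0≤inf , moves)) = ≤-<-trans 0≤inf (infimum-< (v ⊖ u) moves)

    constant-<ᴮ⇒< : ∀ {a u} → constant a <ᴮ u → a < ⟦ u ⟧ ε δ
    constant-<ᴮ⇒< {a} a<u = subst (_< _) (⟦constant⟧ a ε δ) (<ᴮ-sound a<u)

    constant-≤ᴮ⇒≤ : ∀ {a u} → constant a ≤ᴮ u → a ≤ ⟦ u ⟧ ε δ
    constant-≤ᴮ⇒≤ {a} a≤u = subst (_≤ _) (⟦constant⟧ a ε δ) (≤ᴮ-sound a≤u)

    ≤ᴮ-constant⇒≤ : ∀ {u a} → u ≤ᴮ constant a → ⟦ u ⟧ ε δ ≤ a
    ≤ᴮ-constant⇒≤ {u} {a} u≤a = subst (_ ≤_) (⟦constant⟧ a ε δ) (≤ᴮ-sound u≤a)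

-- Items, and the items crossing one horizontal line

-- δ⁺ < 1/6000 makes every width exceed 1/5, and ε⁺ < 1/84 keeps the shortest heights above 1/7.
ε⁺ δ⁺ : ℚ
ε⁺ = q 1 100
δ⁺ = q 1 12000

open OpenBox ε⁺ δ⁺

widthᴬ : ItemType → Affine
widthᴬ zero                                                 = affine (q 1 4) 0ℚ (- q 300 1)
widthᴬ (suc zero)                                           = affine (q 1 4) 0ℚ (q 100 1)
widthᴬ (suc (suc zero))                                     = affine (q 1 2) 0ℚ (q 200 1)
widthᴬ (suc (suc (suc zero)))                               = affine (q 1 4) 0ℚ (- q 30 1)
widthᴬ (suc (suc (suc (suc zero))))                         = affine (q 1 4) 0ℚ (q 10 1)
widthᴬ (suc (suc (suc (suc (suc zero)))))                   = affine (q 1 2) 0ℚ (q 20 1)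
widthᴬ (suc (suc (suc (suc (suc (suc zero))))))             = affine (q 1 4) 0ℚ (- q 3 1)
widthᴬ (suc (suc (suc (suc (suc (suc (suc zero)))))))       = affine (q 1 4) 0ℚ 1ℚ
widthᴬ (suc (suc (suc (suc (suc (suc (suc (suc zero)))))))) = affine (q 1 2) 0ℚ (q 2 1)

heightᴬ : ItemType → Affine
heightᴬ zero                                                 = affine (q 1 6) (- q 2 1) 0ℚ
heightᴬ (suc zero)                                           = affine (q 1 6) (- q 2 1) 0ℚ
heightᴬ (suc (suc zero))                                     = affine (q 1 6) (- q 2 1) 0ℚ
heightᴬ (suc (suc (suc zero)))                               = affine (q 1 3) 1ℚ 0ℚ
heightᴬ (suc (suc (suc (suc zero))))                         = affine (q 1 3) 1ℚ 0ℚ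
heightᴬ (suc (suc (suc (suc (suc zero)))))                   = affine (q 1 3) 1ℚ 0ℚ
heightᴬ (suc (suc (suc (suc (suc (suc zero))))))             = affine (q 1 2) 1ℚ 0ℚ
heightᴬ (suc (suc (suc (suc (suc (suc (suc zero)))))))       = affine (q 1 2) 1ℚ 0ℚ
heightᴬ (suc (suc (suc (suc (suc (suc (suc (suc zero)))))))) = affine (q 1 2) 1ℚ 0ℚ

private
  module AsAffine (ε δ : ℚ) where
    open +-*-Solver hiding (⟦_⟧)

    plus-δ : ∀ a c → a + c * δ ≡ ⟦ affine a 0ℚ c ⟧ ε δ
    plus-δ a c = solve 4 (λ a c ε δ → a :+ c :* δ := a :+ con 0ℚ :* ε :+ c :* δ) refl a c ε δ

    minus-δ : ∀ a c → a - c * δ ≡ ⟦ affine a 0ℚ (- c) ⟧ ε δ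
    minus-δ a c = solve 4 (λ a c ε δ → a :- c :* δ := a :+ con 0ℚ :* ε :+ (:- c) :* δ) refl a c ε δ

    plus-1δ : ∀ a → a + δ ≡ ⟦ affine a 0ℚ 1ℚ ⟧ ε δ
    plus-1δ a = solve 3 (λ a ε δ → a :+ δ := a :+ con 0ℚ :* ε :+ con 1ℚ :* δ) refl a ε δ

    plus-1ε : ∀ a → a + ε ≡ ⟦ affine a 1ℚ 0ℚ ⟧ ε δ
    plus-1ε a = solve 3 (λ a ε δ → a :+ ε := a :+ con 1ℚ :* ε :+ con 0ℚ :* δ) refl a ε δ

    minus-ε : ∀ a c → a - c * ε ≡ ⟦ affine a (- c) 0ℚ ⟧ ε δ
    minus-ε a c = solve 4 (λ a c ε δ → a :- c :* ε := a :+ (:- c) :* ε :+ con 0ℚ :* δ) refl a c ε δ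

width≡⟦widthᴬ⟧ : ∀ ε δ t → width ε δ t ≡ ⟦ widthᴬ t ⟧ ε δ
width≡⟦widthᴬ⟧ ε δ zero                                                 = AsAffine.minus-δ ε δ (q 1 4) (q 300 1)
width≡⟦widthᴬ⟧ ε δ (suc zero)                                           = AsAffine.plus-δ ε δ (q 1 4) (q 100 1)
width≡⟦widthᴬ⟧ ε δ (suc (suc zero))                                     = AsAffine.plus-δ ε δ (q 1 2) (q 200 1)
width≡⟦widthᴬ⟧ ε δ (suc (suc (suc zero)))                               = AsAffine.minus-δ ε δ (q 1 4) (q 30 1)
width≡⟦widthᴬ⟧ ε δ (suc (suc (suc (suc zero))))                         = AsAffine.plus-δ ε δ (q 1 4) (q 10 1)
width≡⟦widthᴬ⟧ ε δ (suc (suc (suc (suc (suc zero)))))                   = AsAffine.plus-δ ε δ (q 1 2) (q 20 1)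
width≡⟦widthᴬ⟧ ε δ (suc (suc (suc (suc (suc (suc zero))))))             = AsAffine.minus-δ ε δ (q 1 4) (q 3 1)
width≡⟦widthᴬ⟧ ε δ (suc (suc (suc (suc (suc (suc (suc zero)))))))       = AsAffine.plus-1δ ε δ (q 1 4)
width≡⟦widthᴬ⟧ ε δ (suc (suc (suc (suc (suc (suc (suc (suc zero)))))))) = AsAffine.plus-δ ε δ (q 1 2) (q 2 1)

height≡⟦heightᴬ⟧ : ∀ ε δ t → height ε δ t ≡ ⟦ heightᴬ t ⟧ ε δ
height≡⟦heightᴬ⟧ ε δ zero                                                 = AsAffine.minus-ε ε δ (q 1 6) (q 2 1)
height≡⟦heightᴬ⟧ ε δ (suc zero)                                           = AsAffine.minus-ε ε δ (q 1 6) (q 2 1)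
height≡⟦heightᴬ⟧ ε δ (suc (suc zero))                                     = AsAffine.minus-ε ε δ (q 1 6) (q 2 1)
height≡⟦heightᴬ⟧ ε δ (suc (suc (suc zero)))                               = AsAffine.plus-1ε ε δ (q 1 3)
height≡⟦heightᴬ⟧ ε δ (suc (suc (suc (suc zero))))                         = AsAffine.plus-1ε ε δ (q 1 3)
height≡⟦heightᴬ⟧ ε δ (suc (suc (suc (suc (suc zero)))))                   = AsAffine.plus-1ε ε δ (q 1 3)
height≡⟦heightᴬ⟧ ε δ (suc (suc (suc (suc (suc (suc zero))))))             = AsAffine.plus-1ε ε δ (q 1 2)
height≡⟦heightᴬ⟧ ε δ (suc (suc (suc (suc (suc (suc (suc zero)))))))       = AsAffine.plus-1ε ε δ (q 1 2)
height≡⟦heightᴬ⟧ ε δ (suc (suc (suc (suc (suc (suc (suc (suc zero)))))))) = AsAffine.plus-1ε ε δ (q 1 2)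

lineValue : ItemType → ℕ
lineValue zero                                                 = 0
lineValue (suc zero)                                           = 48
lineValue (suc (suc zero))                                     = 96
lineValue (suc (suc (suc zero)))                               = 36
lineValue (suc (suc (suc (suc zero))))                         = 36
lineValue (suc (suc (suc (suc (suc zero)))))                   = 72
lineValue (suc (suc (suc (suc (suc (suc zero))))))             = 24
lineValue (suc (suc (suc (suc (suc (suc (suc zero)))))))       = 24
lineValue (suc (suc (suc (suc (suc (suc (suc (suc zero)))))))) = 48

totalWidth : ℚ → ℚ → List ItemType → ℚ
totalWidth ε δ = foldr (λ t s → width ε δ t + s) 0ℚ

totalWidthᴬ : List ItemType → Affine
totalWidthᴬ = foldr (λ t s → widthᴬ t ⊕ s) (constant 0ℚ)

totalWidth≡⟦totalWidthᴬ⟧ : ∀ ε δ ts → totalWidth ε δ ts ≡ ⟦ totalWidthᴬ ts ⟧ ε δ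
totalWidth≡⟦totalWidthᴬ⟧ ε δ []       = sym (⟦constant⟧ 0ℚ ε δ)
totalWidth≡⟦totalWidthᴬ⟧ ε δ (t ∷ ts) =
  trans (cong₂ _+_ (width≡⟦widthᴬ⟧ ε δ t) (totalWidth≡⟦totalWidthᴬ⟧ ε δ ts)) (sym (⟦⊕⟧ (widthᴬ t) (totalWidthᴬ ts) ε δ))

FitsOrTooWide : List ItemType → Set
FitsOrTooWide ts = sum (map lineValue ts) ℕ.≤ 144 ⊎ constant 1ℚ <ᴮ totalWidthᴬ ts

fitsOrTooWide-short : ∀ ts → length ts ℕ.≤ 4 → FitsOrTooWide ts
fitsOrTooWide-short = from-yes (∀-length≤? (λ ts → sum (map lineValue ts) ℕ.≤? 144 ⊎-dec constant 1ℚ <ᴮ? totalWidthᴬ ts) 4)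

module _ {ε δ : ℚ} (box : InBox ε δ) where

  width>⅕ : ∀ t → q 1 5 < width ε δ t
  width>⅕ t = subst (_ <_) (sym (width≡⟦widthᴬ⟧ ε δ t)) (constant-<ᴮ⇒< box (certificate t))
    where
    certificate : ∀ t → constant (q 1 5) <ᴮ widthᴬ t
    certificate = from-yes (all? (λ t → constant (q 1 5) <ᴮ? widthᴬ t))

  fifths≤totalWidth : ∀ ts → q (length ts) 5 ≤ totalWidth ε δ ts
  fifths≤totalWidth []       = ≤-refl
  fifths≤totalWidth (t ∷ ts) = subst (_≤ totalWidth ε δ (t ∷ ts)) (sym (q-+ 1 (length ts) 4))
    (+-mono-≤ (<⇒≤ (width>⅕ t)) (fifths≤totalWidth ts))

  knapsack : ∀ ts → totalWidth ε δ ts ≤ 1ℚ → sum (map lineValue ts) ℕ.≤ 144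
  knapsack []            _       = z≤n
  knapsack ts@(t ∷ ts′) ts-fits = [ short , long ]′ (ℕ.≤-<-connex (length ts) 4)
    where
    open ≤-Reasoning

    short : length ts ℕ.≤ 4 → sum (map lineValue ts) ℕ.≤ 144
    short |ts|≤4 = [ id , (λ too-wide → contradiction ts-fits (<⇒≱ (begin-strict
        1ℚ                      <⟨ constant-<ᴮ⇒< box too-wide ⟩
        ⟦ totalWidthᴬ ts ⟧ ε δ  ≡⟨ totalWidth≡⟦totalWidthᴬ⟧ ε δ ts ⟨
        totalWidth ε δ ts       ∎))) ]′ (fitsOrTooWide-short ts |ts|≤4)

    long : 4 ℕ.< length ts → sum (map lineValue ts) ℕ.≤ 144
    long 4<|ts| = contradiction ts-fits (<⇒≱ (begin-strict
        1ℚ                          ≤⟨ q-mono-≤ 4 4<|ts| ⟩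
        q (length ts) 5             ≡⟨ q-+ 1 (length ts′) 4 ⟩
        q 1 5 + q (length ts′) 5    <⟨ +-mono-<-≤ (width>⅕ t) (fifths≤totalWidth ts′) ⟩
        totalWidth ε δ ts           ∎))

-- Horizontal lines crossed by one item

inBlock : ℕ → ℕ → ℕ → Bool
inBlock a r j = (a <ᵇ suc j) ∧ (j <ᵇ a ℕ.+ r)

block-size : ∀ n a r → a ℕ.+ r ℕ.≤ n → ∑[ j < n ] 𝟙 (inBlock a r (toℕ j)) ≡ r
block-size zero    zero    zero    _          = refl
block-size (suc n) zero    zero    _          = block-size n zero zero z≤n
block-size (suc n) zero    (suc r) (s≤s r≤n)  = cong suc (block-size n zero r r≤n)
block-size (suc n) (suc a) r       (s≤s a+r≤n) = block-size n a r a+r≤n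

level : Fin 6 → ℚ
level j = q (suc (toℕ j)) 7

Crosses : ℚ → ℚ → Fin 6 → Set
Crosses y h j = y < level j × level j < y + h

crosses? : ∀ y h j → Dec (Crosses y h j)
crosses? y h j = (y <? level j) ×-dec (level j <? y + h)

crossings : ℚ → ℚ → ℕ
crossings y h = ∑[ j < 6 ] 𝟙 (isYes (crosses? y h j))

bracket : ∀ {y} → 0ℚ ≤ y → ∀ k → y < q k 7 → ∃[ a ] (q a 7 ≤ y × y < q (suc a) 7)
bracket 0≤y zero    y<0 = contradiction 0≤y (<⇒≱ y<0)
bracket {y} 0≤y (suc k) y<k+1 with q k 7 ≤? y
... | yes k≤y = k , k≤y , y<k+1
... | no  k≰y = bracket 0≤y k (≰⇒> k≰y)

-- If a/7 ≤ y < (a+1)/7, the lines (a+1)/7, …, (a+r)/7 all lie strictly inside (y, y + h).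
crossings-≥ : ∀ {y h} r → 0ℚ ≤ y → y + h ≤ 1ℚ → q r 7 < h → r ℕ.≤ crossings y h
crossings-≥ {y} {h} r 0≤y y+h≤1 r<h = from-bracket (bracket 0≤y 7 y<1)
  where
  y<1 : y < 1ℚ
  y<1 = <-≤-trans (begin-strict
      y        ≡⟨ +-identityʳ y ⟨
      y + 0ℚ   <⟨ +-monoʳ-< y (≤-<-trans (q-mono-≤ {0} {r} 6 z≤n) r<h) ⟩
      y + h    ∎) y+h≤1
    where open ≤-Reasoning

  from-bracket : ∃[ a ] (q a 7 ≤ y × y < q (suc a) 7) → r ℕ.≤ crossings y h
  from-bracket (a , a≤y , y<a+1) =
    subst (ℕ._≤ crossings y h) (block-size 6 a r a+r≤6)
      (∑-mono-≤ block≤crossing)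
    where
    a+r<y+h : q (a ℕ.+ r) 7 < y + h
    a+r<y+h = begin-strict
      q (a ℕ.+ r) 7    ≡⟨ q-+ a r 6 ⟩
      q a 7 + q r 7    ≤⟨ +-monoˡ-≤ (q r 7) a≤y ⟩
      y + q r 7        <⟨ +-monoʳ-< y r<h ⟩
      y + h            ∎
      where open ≤-Reasoning

    a+r≤6 : a ℕ.+ r ℕ.≤ 6
    a+r≤6 = ℕ.≤-pred (q-cancel-< 6 (<-≤-trans a+r<y+h y+h≤1))

    block⇒crosses : ∀ j → T (inBlock a r (toℕ j)) → Crosses y h j
    block⇒crosses j j∈block =
        <-≤-trans y<a+1 (q-mono-≤ 6 (ℕ.<ᵇ⇒< a (suc (toℕ j)) a≤j))
      , ≤-<-trans (q-mono-≤ 6 (ℕ.<ᵇ⇒< (toℕ j) (a ℕ.+ r) j<a+r)) a+r<y+h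
      where
      a≤j   = proj₁ (Equivalence.to T-∧ j∈block)
      j<a+r = proj₂ (Equivalence.to T-∧ j∈block)

    block≤crossing : ∀ j → 𝟙 (inBlock a r (toℕ j)) ℕ.≤ 𝟙 (isYes (crosses? y h j))
    block≤crossing j = 𝟙-mono (λ j∈block → fromWitness {a? = crosses? y h j} (block⇒crosses j j∈block))

-- Double counting

sum-items : ∀ (p : Pattern) (f : ItemType → ℕ) is →
  sum (map f (concatMap (λ i → replicate (p i) i) is)) ≡ sum (map (λ i → f i ℕ.* p i) is)
sum-items p f []       = refl
sum-items p f (i ∷ is) = begin
  sum (map f (replicate (p i) i ++ concatMap (λ i → replicate (p i) i) is))          ≡⟨ cong sum (map-++ f (replicate (p i) i) _) ⟩
  sum (map f (replicate (p i) i) ++ map f (concatMap (λ i → replicate (p i) i) is))  ≡⟨ sum-++ (map f (replicate (p i) i)) _ ⟩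
  sum (map f (replicate (p i) i)) ℕ.+ sum (map f (concatMap (λ i → replicate (p i) i) is))
                                                                                      ≡⟨ cong₂ ℕ._+_ (sum-map-replicate f (p i) i) (sum-items p f is) ⟩
  f i ℕ.* p i ℕ.+ sum (map (λ i → f i ℕ.* p i) is)                                   ∎
  where open ≡-Reasoning

linesCrossed : ItemType → ℕ
linesCrossed zero                                                 = 1
linesCrossed (suc zero)                                           = 1
linesCrossed (suc (suc zero))                                     = 1
linesCrossed (suc (suc (suc zero)))                               = 2
linesCrossed (suc (suc (suc (suc zero))))                         = 2
linesCrossed (suc (suc (suc (suc (suc zero)))))                   = 2
linesCrossed (suc (suc (suc (suc (suc (suc zero))))))             = 3
linesCrossed (suc (suc (suc (suc (suc (suc (suc zero)))))))       = 3
linesCrossed (suc (suc (suc (suc (suc (suc (suc (suc zero)))))))) = 3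

-- 413 λ_t for the types t ≥ 2 that w counts.
itemValue : ItemType → ℕ
itemValue t = linesCrossed t ℕ.* lineValue t

lam≡itemValue/413 : All (λ i → lam i ≡ q (itemValue i) 413) (drop 1 (allFin 9))
lam≡itemValue/413 = from-yes (All.all? (λ i → lam i ≟ q (itemValue i) 413) (drop 1 (allFin 9)))

module _ {ε δ : ℚ} (box : InBox ε δ) where

  linesCrossed<height : ∀ t → q (linesCrossed t) 7 < height ε δ t
  linesCrossed<height t = subst (_ <_) (sym (height≡⟦heightᴬ⟧ ε δ t)) (constant-<ᴮ⇒< box (certificate t))
    where
    certificate : ∀ t → constant (q (linesCrossed t) 7) <ᴮ heightᴬ t
    certificate = from-yes (all? (λ t → constant (q (linesCrossed t) 7) <ᴮ? heightᴬ t))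

  module PackingBound {p : Pattern} (packing : Packing ε δ p) where

    n : ℕ
    n = length (items p)

    type : Fin n → ItemType
    type = lookup (items p)

    x y w h : Fin n → ℚ
    x k = proj₁ (proj₁ packing k)
    y k = proj₂ (proj₁ packing k)
    w k = width ε δ (type k)
    h k = height ε δ (type k)

    inside : ∀ k → (0ℚ ≤ x k) × (x k + w k ≤ 1ℚ) × (0ℚ ≤ y k) × (y k + h k ≤ 1ℚ)
    inside = proj₁ (proj₂ packing)

    open Intervals x w

    x<x+w : ∀ k → x k < x k + w k
    x<x+w k = subst (_< x k + w k) (+-identityʳ (x k)) (+-monoʳ-< (x k) (<-trans (from-yes (0ℚ <? q 1 5)) (width>⅕ box (type k))))

    crosses-at? : ∀ j k → Dec (Crosses (y k) (h k) j)
    crosses-at? j k = crosses? (y k) (h k) j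

    -- Two items crossing the same level share the interior point (z, level j) unless their x-ranges are disjoint.
    crossing-disjoint : ∀ j {k l} → k ≢ l → Crosses (y k) (h k) j → Crosses (y l) (h l) j → Disjoint k l
    crossing-disjoint j {k} {l} k≢l (yk<j , j<yk+hk) (yl<j , j<yl+hl) = decide (x k + w k ≤? x l) (x l + w l ≤? x k)
      where
      decide : Dec (x k + w k ≤ x l) → Dec (x l + w l ≤ x k) → Disjoint k l
      decide (yes k-left) _            = inj₁ k-left
      decide (no _)       (yes l-left) = inj₂ l-left
      decide (no k≰)      (no l≰)      = contradiction (open-intervals-meet (x<x+w k) (x<x+w l) (≰⇒> k≰) (≰⇒> l≰)) no-common-point
        where
        no-common-point : ¬ (∃[ z ] ((x k < z × z < x k + w k) × (x l < z × z < x l + w l)))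
        no-common-point (z , (xk<z , z<xk+wk) , (xl<z , z<xl+wl)) =
          proj₂ (proj₂ packing) k l k≢l (z , level j) ((xk<z , z<xk+wk , yk<j , j<yk+hk) , (xl<z , z<xl+wl , yl<j , j<yl+hl))

    crossers : Fin 6 → List (Fin n)
    crossers j = filter (crosses-at? j) (allFin n)

    crossers-disjoint : ∀ j → AllPairs Disjoint (crossers j)
    crossers-disjoint j =
      pairwise (AllPairs.filter⁺ (crosses-at? j) (Unique.allFin⁺ n)) (All.all-filter (crosses-at? j) (allFin n))
      where
      pairwise : ∀ {S} → AllPairs _≢_ S → All (λ k → Crosses (y k) (h k) j) S → AllPairs Disjoint S
      pairwise []                    []                     = []
      pairwise (k≢S ∷ S-distinct) (k-crosses ∷ S-crosses) =
        All.zipWith (λ (k≢l , l-crosses) → crossing-disjoint j k≢l k-crosses l-crosses) (k≢S , S-crosses)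
        ∷ pairwise S-distinct S-crosses

    within-bin : ∀ k → Within 0ℚ 1ℚ k
    within-bin k = proj₁ (inside k) , proj₁ (proj₂ (inside k))

    line-value≤144 : ∀ j → ∑[ k < n ] (𝟙 (isYes (crosses-at? j k)) ℕ.* lineValue (type k)) ℕ.≤ 144
    line-value≤144 j = begin
      ∑[ k < n ] (𝟙 (isYes (crosses-at? j k)) ℕ.* lineValue (type k))  ≡⟨ ∑-𝟙*≡sum-filter (crosses-at? j) (lineValue ∘ type) (λ k → k) ⟩
      sum (map (lineValue ∘ type) (crossers j))                        ≡⟨ cong sum (map-∘ (crossers j)) ⟩
      sum (map lineValue (map type (crossers j)))                      ≤⟨ knapsack box (map type (crossers j)) fits ⟩
      144                                                              ∎
      where
      open ℕ.≤-Reasoning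
      fits : totalWidth ε δ (map type (crossers j)) ≤ 1ℚ
      fits = subst (_≤ 1ℚ) (trans (+-identityˡ _) (sym (foldr-map _ type 0ℚ (crossers j))))
        (totalLength-≤ (crossers j) (crossers-disjoint j) (All.universal within-bin (crossers j)) (from-yes (0ℚ ≤? 1ℚ)))

    item-value≤ : ∀ k → itemValue (type k) ℕ.≤ ∑[ j < 6 ] (𝟙 (isYes (crosses-at? j k)) ℕ.* lineValue (type k))
    item-value≤ k = begin
      linesCrossed (type k) ℕ.* lineValue (type k)  ≤⟨ ℕ.*-monoˡ-≤ (lineValue (type k)) spanned≤crossings ⟩
      crossings (y k) (h k) ℕ.* lineValue (type k)   ≡⟨ *-distribʳ-sum (lineValue (type k)) (λ j → 𝟙 (isYes (crosses-at? j k))) ⟩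
      ∑[ j < 6 ] (𝟙 (isYes (crosses-at? j k)) ℕ.* lineValue (type k)) ∎
      where
      open ℕ.≤-Reasoning
      spanned≤crossings : linesCrossed (type k) ℕ.≤ crossings (y k) (h k)
      spanned≤crossings = crossings-≥ (linesCrossed (type k))
        (proj₁ (proj₂ (proj₂ (inside k)))) (proj₂ (proj₂ (proj₂ (inside k)))) (linesCrossed<height (type k))

    items-value≤864 : ∑[ k < n ] itemValue (type k) ℕ.≤ 864
    items-value≤864 = begin
      ∑[ k < n ] itemValue (type k)                                               ≤⟨ ∑-mono-≤ item-value≤ ⟩
      ∑[ k < n ] ∑[ j < 6 ] (𝟙 (isYes (crosses-at? j k)) ℕ.* lineValue (type k))  ≡⟨ ∑-comm (λ k j → 𝟙 (isYes (crosses-at? j k)) ℕ.* lineValue (type k)) ⟩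
      ∑[ j < 6 ] ∑[ k < n ] (𝟙 (isYes (crosses-at? j k)) ℕ.* lineValue (type k))  ≤⟨ ∑-mono-≤ line-value≤144 ⟩
      ∑[ j < 6 ] 144                                                              ∎
      where open ℕ.≤-Reasoning

weight≡ : ∀ p → weight p ≡ q (sum (map (λ i → itemValue i ℕ.* p i) (drop 1 (allFin 9)))) 413
weight≡ p = go (drop 1 (allFin 9)) lam≡itemValue/413
  where
  go : ∀ is → All (λ i → lam i ≡ q (itemValue i) 413) is →
       foldr _+_ 0ℚ (map (λ i → lam i * q (p i) 1) is) ≡ q (sum (map (λ i → itemValue i ℕ.* p i) is)) 413
  go []       []               = refl
  go (i ∷ is) (lam≡ ∷ lams≡) = begin
    lam i * q (p i) 1 + foldr _+_ 0ℚ (map (λ i → lam i * q (p i) 1) is)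
      ≡⟨ cong₂ _+_ (trans (cong (_* q (p i) 1) lam≡) (q-*-q1 (itemValue i) (p i) 412)) (go is lams≡) ⟩
    q (itemValue i ℕ.* p i) 413 + q (sum (map (λ i → itemValue i ℕ.* p i) is)) 413
      ≡⟨ q-+ (itemValue i ℕ.* p i) _ 412 ⟨
    q (itemValue i ℕ.* p i ℕ.+ sum (map (λ i → itemValue i ℕ.* p i) is)) 413
      ∎
    where open ≡-Reasoning

weight≤864/413 : ∀ {ε δ} → InBox ε δ → ∀ p → Packing ε δ p → weight p ≤ q 864 413
weight≤864/413 box p packing = begin
  weight p                                                       ≡⟨ weight≡ p ⟩
  q (sum (map (λ i → itemValue i ℕ.* p i) (drop 1 (allFin 9)))) 413  ≤⟨ q-mono-≤ 412 (subst (ℕ._≤ 864) total≡ items-value≤864) ⟩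
  q 864 413                                                      ∎
  where
  open ≤-Reasoning
  open PackingBound box {p} packing
  total≡ : ∑[ k < n ] itemValue (type k) ≡ sum (map (λ i → itemValue i ℕ.* p i) (drop 1 (allFin 9)))
  total≡ = trans (∑-lookup itemValue (items p)) (sum-items p itemValue (allFin 9))

-- The three optimal patterns

Layout : Set
Layout = ℕ → Affine × Affine

module LayoutOf (r : Pattern) (layout : Layout) where

  n : ℕ
  n = length (items r)

  type : Fin n → ItemType
  type = lookup (items r)

  xᴬ yᴬ : Fin n → Affine
  xᴬ k = proj₁ (layout (toℕ k))
  yᴬ k = proj₂ (layout (toℕ k))

  InsideBin : Fin n → Set
  InsideBin k = constant 0ℚ ≤ᴮ xᴬ k × xᴬ k ⊕ widthᴬ (type k) ≤ᴮ constant 1ℚ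
              × constant 0ℚ ≤ᴮ yᴬ k × yᴬ k ⊕ heightᴬ (type k) ≤ᴮ constant 1ℚ

  Separated : Fin n → Fin n → Set
  Separated k l = k ≡ l ⊎ xᴬ k ⊕ widthᴬ (type k) ≤ᴮ xᴬ l ⊎ xᴬ l ⊕ widthᴬ (type l) ≤ᴮ xᴬ k
                        ⊎ yᴬ k ⊕ heightᴬ (type k) ≤ᴮ yᴬ l ⊎ yᴬ l ⊕ heightᴬ (type l) ≤ᴮ yᴬ k

  Valid : Set
  Valid = (∀ k → InsideBin k) × (∀ k l → Separated k l)

  valid? : Dec Valid
  valid? = all? inside? ×-dec all? (λ k → all? (separated? k))
    where
    inside? : ∀ k → Dec (InsideBin k)
    inside? k = constant 0ℚ ≤ᴮ? xᴬ k ×-dec xᴬ k ⊕ widthᴬ (type k) ≤ᴮ? constant 1ℚ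
          ×-dec constant 0ℚ ≤ᴮ? yᴬ k ×-dec yᴬ k ⊕ heightᴬ (type k) ≤ᴮ? constant 1ℚ
    separated? : ∀ k l → Dec (Separated k l)
    separated? k l = k Fin.≟ l ⊎-dec xᴬ k ⊕ widthᴬ (type k) ≤ᴮ? xᴬ l ⊎-dec xᴬ l ⊕ widthᴬ (type l) ≤ᴮ? xᴬ k
               ⊎-dec yᴬ k ⊕ heightᴬ (type k) ≤ᴮ? yᴬ l ⊎-dec yᴬ l ⊕ heightᴬ (type l) ≤ᴮ? yᴬ k

  valid⇒packing : ∀ {ε δ} → InBox ε δ → Valid → Packing ε δ r
  valid⇒packing {ε} {δ} box (inside , separated) = position , within-bin , disjoint
    where
    x y w h : Fin n → ℚ
    x k = ⟦ xᴬ k ⟧ ε δ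
    y k = ⟦ yᴬ k ⟧ ε δ
    w k = width ε δ (type k)
    h k = height ε δ (type k)

    position : Fin n → ℚ × ℚ
    position k = x k , y k

    ⟦x⊕width⟧ : ∀ k → ⟦ xᴬ k ⊕ widthᴬ (type k) ⟧ ε δ ≡ x k + w k
    ⟦x⊕width⟧ k = trans (⟦⊕⟧ (xᴬ k) (widthᴬ (type k)) ε δ) (cong (x k +_) (sym (width≡⟦widthᴬ⟧ ε δ (type k))))

    ⟦y⊕height⟧ : ∀ k → ⟦ yᴬ k ⊕ heightᴬ (type k) ⟧ ε δ ≡ y k + h k
    ⟦y⊕height⟧ k = trans (⟦⊕⟧ (yᴬ k) (heightᴬ (type k)) ε δ) (cong (y k +_) (sym (height≡⟦heightᴬ⟧ ε δ (type k))))

    within-bin : ∀ k → (0ℚ ≤ x k) × (x k + w k ≤ 1ℚ) × (0ℚ ≤ y k) × (y k + h k ≤ 1ℚ)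
    within-bin k = from-certificate (inside k)
      where
      from-certificate : InsideBin k → (0ℚ ≤ x k) × (x k + w k ≤ 1ℚ) × (0ℚ ≤ y k) × (y k + h k ≤ 1ℚ)
      from-certificate (0≤x , x+w≤1 , 0≤y , y+h≤1) =
          constant-≤ᴮ⇒≤ box 0≤x , subst (_≤ 1ℚ) (⟦x⊕width⟧ k) (≤ᴮ-constant⇒≤ box x+w≤1)
        , constant-≤ᴮ⇒≤ box 0≤y , subst (_≤ 1ℚ) (⟦y⊕height⟧ k) (≤ᴮ-constant⇒≤ box y+h≤1)

    right-of : ∀ {k l} → xᴬ k ⊕ widthᴬ (type k) ≤ᴮ xᴬ l → x k + w k ≤ x l
    right-of {k} k-left = subst (_≤ _) (⟦x⊕width⟧ k) (≤ᴮ-sound box k-left)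

    above : ∀ {k l} → yᴬ k ⊕ heightᴬ (type k) ≤ᴮ yᴬ l → y k + h k ≤ y l
    above {k} k-below = subst (_≤ _) (⟦y⊕height⟧ k) (≤ᴮ-sound box k-below)

    gap : ∀ {a b c} → a < b → b ≤ c → ¬ (c < a)
    gap a<b b≤c = <⇒≱ (<-≤-trans a<b b≤c) ∘′ <⇒≤

    disjoint : ∀ k l → k ≢ l → ∀ z → ¬ (InInterior ε δ (type k) (position k) z × InInterior ε δ (type l) (position l) z)
    disjoint k l k≢l z ((xk<z , z<xk+wk , yk<z , z<yk+hk) , (xl<z , z<xl+wl , yl<z , z<yl+hl)) = apart (separated k l)
      where
      apart : ¬ Separated k l
      apart (inj₁ k≡l)                          = k≢l k≡l
      apart (inj₂ (inj₁ k-left))                = gap z<xk+wk (right-of k-left) xl<z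
      apart (inj₂ (inj₂ (inj₁ l-left)))         = gap z<xl+wl (right-of l-left) xk<z
      apart (inj₂ (inj₂ (inj₂ (inj₁ k-below)))) = gap z<yk+hk (above k-below) yl<z
      apart (inj₂ (inj₂ (inj₂ (inj₂ l-below)))) = gap z<yl+hl (above l-below) yk<z

-- Items of type 2 go three to a row, in rows 1/6 apart from the bottom up.
shortRows : Layout
shortRows m = constant (q (m % 3) 3) , constant (q (m / 3) 6)

-- Items of type 4 go four to a row; row 0 starts at 1/3 - 2ε (the top of two rows of type 2), row 1 at 2/3 - ε and ends at 1.
tallRows : Layout
tallRows m = constant (q (m % 4) 4) , base (m / 4)
  where
  base : ℕ → Affine
  base zero    = affine (q 1 3) (- q 2 1) 0ℚ
  base (suc _) = affine (q 2 3) (- 1ℚ) 0ℚ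

packing-6-8 : ∀ {ε δ} → InBox ε δ → Packing ε δ (pat 0 6 0 8 0 0 0 0 0)
packing-6-8 box = valid⇒packing box (from-yes valid?)
  where open LayoutOf (pat 0 6 0 8 0 0 0 0 0) (λ m → if m <ᵇ 6 then shortRows m else tallRows (m ∸ 6))

packing-12-4 : ∀ {ε δ} → InBox ε δ → Packing ε δ (pat 0 12 0 4 0 0 0 0 0)
packing-12-4 box = valid⇒packing box (from-yes valid?)
  where open LayoutOf (pat 0 12 0 4 0 0 0 0 0) (λ m → if m <ᵇ 12 then shortRows m else tallRows (4 ℕ.+ (m ∸ 12)))

packing-18 : ∀ {ε δ} → InBox ε δ → Packing ε δ (pat 0 18 0 0 0 0 0 0 0)
packing-18 box = valid⇒packing box (from-yes valid?)
  where open LayoutOf (pat 0 18 0 0 0 0 0 0 0) shortRows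

attains-864/413 : ∀ {ε δ} → InBox ε δ → ∀ r → Packing ε δ r → r zero ≡ 0 → r two ≢ 0 → weight r ≡ q 864 413 →
                  AttainsMaxT2 ε δ r
attains-864/413 box r r-packing r₁≡0 r₂≢0 weight-r =
  (r-packing , below-two , r₂≢0) , λ p (p-packing , _) → subst (weight p ≤_) (sym weight-r) (weight≤864/413 box p p-packing)
  where
  below-two : ∀ i → toℕ i ℕ.< toℕ two → r i ≡ 0
  below-two zero    _            = r₁≡0
  below-two (suc i) (s≤s ())

lemma2 : ∃[ ε₀ ] ∃[ δ₀ ] ((0ℚ < ε₀) × (0ℚ < δ₀) ×
           (∀ (ε δ : ℚ) → 0ℚ < ε → ε < ε₀ → 0ℚ < δ → δ < δ₀ →
             AttainsMaxT2 ε δ (pat 0 6 0 8 0 0 0 0 0)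
             × AttainsMaxT2 ε δ (pat 0 12 0 4 0 0 0 0 0)
             × AttainsMaxT2 ε δ (pat 0 18 0 0 0 0 0 0 0)))
lemma2 = ε⁺ , δ⁺ , from-yes (0ℚ <? ε⁺) , from-yes (0ℚ <? δ⁺) , λ ε δ 0<ε ε<ε⁺ 0<δ δ<δ⁺ →
  let box = record { 0<ε = 0<ε ; ε<ε⁺ = ε<ε⁺ ; 0<δ = 0<δ ; δ<δ⁺ = δ<δ⁺ } in
    attains-864/413 box _ (packing-6-8 box)  refl (λ ()) refl
  , attains-864/413 box _ (packing-12-4 box) refl (λ ()) refl
  , attains-864/413 box _ (packing-18 box)   refl (λ ()) refl
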